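{- Let $n\geq 3$ and $\vec{x}\in\mathbb{Z}^n$. If $\vec{x}(2)\leq\vec{x}(3)$, then $f(\vec{x})$ is either $\vec{x}(2)$ or $\vec{x}(3)$. In particular, if $\vec{x}(2)=\vec{x}(3)$, then $f(\vec{x})=\vec{x}(2)$.
   Context: For $\vec{x}\in\mathbb{Z}^n$ write $\vec{x}(i)$ for its $i$-th entry. $k(\vec{x})=n$ if $\vec{x}(1)>\cdots>\vec{x}(n)$, otherwise the least $k$ with $\vec{x}(k)\leq\vec{x}(k+1)$. $l(\vec{x})$ is the least $l$ with $1\leq l<k(\vec{x})$, $\vec{x}(l)>\vec{x}(l+1)+1$ and $\vec{x}(l+1)=\vec{x}(l+2)+1$ if it exists, otherwise $k(\vec{x})-1$. The function $f:\mathbb{Z}^n\to\mathbb{Z}$ (Bailey–Cowles) is given by: $f(\vec{x})=\vec{x}(1)$ if $k(\vec{x})=n$, and $f(\vec{x})=\max\{\vec{x}(l(\vec{x})+2),\vec{x}(k(\vec{x})+1)\}$ if $k(\vec{x})<n$. -}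

module Defs where

open import Data.Nat using (ℕ; zero; suc; _∸_)
import Data.Nat as ℕ
open import Data.Integer using (ℤ; _≤?_; _⊔_; _+_; _>_; _≟_) renaming (0ℤ to 0ℤ)
import Data.Integer as ℤ
open import Data.Vec using (Vec; []; _∷_)
open import Data.Bool using (Bool; if_then_else_; _∧_)
open import Relation.Nullary using (does)
open import Data.Integer.Properties using (_<?_)

-- 1-based entry  x(i)  of a vector x ∈ ℤ^n  (i ranges over 1..n;
-- the value 0 returned out of range is never used by the definitions below).
entry : ∀ {n} → Vec ℤ n → ℕ → ℤ
entry []      _             = 0ℤ
entry (a ∷ v) zero          = 0ℤ
entry (a ∷ v) (suc zero)    = a
entry (a ∷ v) (suc (suc i)) = entry v (suc i)

-- k(x): least k (1 ≤ k < n) with x(k) ≤ x(k+1); n if x is strictly decreasing.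
kSearch : ∀ {n} → Vec ℤ n → (fuel i : ℕ) → ℕ
kSearch {n} x zero     i = n
kSearch {n} x (suc m)  i =
  if does (entry x i ≤? entry x (suc i)) then i else kSearch x m (suc i)

kIdx : ∀ {n} → Vec ℤ n → ℕ
kIdx {n} x = kSearch x (n ∸ 1) 1

-- l(x): least l with 1 ≤ l < k(x), x(l) > x(l+1)+1 and x(l+1) = x(l+2)+1;
-- otherwise k(x) - 1.
lCond : ∀ {n} → Vec ℤ n → ℕ → Bool
lCond x l = does ((entry x (suc l) + ℤ.1ℤ) <? entry x l)
          ∧ does (entry x (suc l) ≟ (entry x (suc (suc l)) + ℤ.1ℤ))

lSearch : ∀ {n} → Vec ℤ n → (default fuel i : ℕ) → ℕ
lSearch x d zero    i = d
lSearch x d (suc m) i = if lCond x i then i else lSearch x d m (suc i)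

lIdx : ∀ {n} → Vec ℤ n → ℕ
lIdx x = lSearch x (kIdx x ∸ 1) (kIdx x ∸ 1) 1

fBC : ∀ {n} → Vec ℤ n → ℤ
fBC {n} x =
  if does (kIdx x ℕ.≟ n)
  then entry x 1
  else entry x (suc (suc (lIdx x))) ⊔ entry x (suc (kIdx x))

module Submission where

open import Defs
open import Data.Nat using (ℕ; suc; s≤s)
import Data.Nat as ℕ
open import Data.Integer using (ℤ; _≤_; _<_; _≤?_)
open import Data.Integer.Properties using (⊔-idem; <⇒≱; ≰⇒>)
open import Data.Bool.Properties using (if-eta)
open import Data.Vec using (Vec; _∷_)
open import Data.Sum using (_⊎_; inj₁; inj₂)
open import Data.Product using (_×_; _,_)
open import Function using (case_of_)
open import Relation.Nullary using (yes; no)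
open import Relation.Nullary.Decidable using (dec-true; dec-false)
open import Relation.Binary.PropositionalEquality using (_≡_; sym; trans)

-- Here k(x) = 1, so l(x) = 0 and both arguments of the maximum are x(2).
fBC-ascent : ∀ {n} (a b : ℤ) (r : Vec ℤ n) → a ≤ b → fBC (a ∷ b ∷ r) ≡ b
fBC-ascent a b r a≤b rewrite dec-true (a ≤? b) a≤b = ⊔-idem b

-- Here k(x) = 2, and l(x) = 1 whether or not the search for l succeeds at 1.
fBC-descent-ascent : ∀ {n} (a b c : ℤ) (r : Vec ℤ n) → b < a → b ≤ c →
                     fBC (a ∷ b ∷ c ∷ r) ≡ c
fBC-descent-ascent a b c r b<a b≤c
  rewrite dec-false (a ≤? b) (<⇒≱ b<a)
        | dec-true (b ≤? c) b≤c
        | if-eta (lCond (a ∷ b ∷ c ∷ r) 1) {1} = ⊔-idem c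

fBC≡second⊎fBC≡third : ∀ {n} (a b c : ℤ) (r : Vec ℤ n) → b ≤ c →
                       fBC (a ∷ b ∷ c ∷ r) ≡ b ⊎ fBC (a ∷ b ∷ c ∷ r) ≡ c
-- A 'with' on  a ≤? b  would abstract it in the goal and block the lemmas above from applying.
fBC≡second⊎fBC≡third a b c r b≤c = case a ≤? b of λ where
  (yes a≤b) → inj₁ (fBC-ascent a b (c ∷ r) a≤b)
  (no  a≰b) → inj₂ (fBC-descent-ascent a b c r (≰⇒> a≰b) b≤c)

lemma3p6 : (n : ℕ) → (x : Vec ℤ n) → 3 ℕ.≤ n → entry x 2 ≤ entry x 3 →
    (fBC x ≡ entry x 2 ⊎ fBC x ≡ entry x 3)
    × (entry x 2 ≡ entry x 3 → fBC x ≡ entry x 2)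
lemma3p6 (suc (suc (suc _))) (a ∷ b ∷ c ∷ r) (s≤s (s≤s (s≤s _))) b≤c =
  f∈bc , equal-case f∈bc
  where
  f∈bc : fBC (a ∷ b ∷ c ∷ r) ≡ b ⊎ fBC (a ∷ b ∷ c ∷ r) ≡ c
  f∈bc = fBC≡second⊎fBC≡third a b c r b≤c
  equal-case : fBC (a ∷ b ∷ c ∷ r) ≡ b ⊎ fBC (a ∷ b ∷ c ∷ r) ≡ c →
               b ≡ c → fBC (a ∷ b ∷ c ∷ r) ≡ b
  equal-case (inj₁ f≡b) _   = f≡b
  equal-case (inj₂ f≡c) b≡c = trans f≡c (sym b≡c)
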